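{- Let $\Sigma$ be a compatible split system on $X$ and let $\Pi\in\mathbb{P}(\Sigma)$. Then $\Delta(\mathcal{T}_\Sigma)\le 2|\Pi|$.
   Context: $X$ is a finite set with $|X|\ge 2$. A partition of $X$ is a set of $t\ge 2$ pairwise disjoint non-empty subsets (parts) whose union is $X$; an $X$-split is a partition with two parts, written $A|(X-A)$. Split systems and partition systems are finite multisets of splits, resp. partitions, of $X$; $|\Pi|$ counts multiplicities. $\Sigma_\Pi=\biguplus_{\pi\in\Pi}\biguplus_{A\in\pi}\{A|(X-A)\}$ (multiset union) and $\mathbb{P}(\Sigma)$ is the set of partition systems $\Pi$ with $\Sigma_\Pi=\Sigma$. A split system is compatible if for any two of its splits $A_1|B_1,A_2|B_2$ one of $A_1\cap A_2,A_1\cap B_2,B_1\cap A_2,B_1\cap B_2$ is empty. A weak $X$-tree $(T;\phi)$ is a tree $T$ with $\phi:X\to V(T)$ such that every leaf lies in $\phi(X)$; each edge $e$ gives the split $\phi^{ -1}(W)|(X-\phi^{ -1}(W))$, $W$ the vertex set of a component of $T-e$. For compatible $\Sigma$, $\mathcal{T}_\Sigma$ is the weak $X$-tree, unique up to isomorphism, whose multiset of edge splits is $\Sigma$. For a tree $T$, the diameter $\Delta(T)=\max\{d_T(u,v): u,v \text{ leaves of } T\}$, where $d_T$ is path length in edges. -}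

module Defs where

open import Data.Nat using (ℕ; zero; suc; _≤_)
open import Data.Fin using (Fin; _≟_)
open import Data.Fin.Subset using (Subset; _∈_; _∉_; ∁; _∩_; Empty; Nonempty)
open import Data.Bool using (Bool; _∨_)
open import Data.List using (List; []; _∷_; length; lookup; removeAt; tabulate; concat; filterᵇ)
open import Data.List.Membership.Propositional as Mem using ()
open import Data.List.Relation.Unary.Any using (Any)
open import Data.List.Relation.Binary.Permutation.Homogeneous using (Permutation)
open import Data.Product using (_×_; _,_; ∃; ∃-syntax; proj₁; proj₂)
open import Data.Sum using (_⊎_)
open import Function.Bundles using (_⇔_)
open import Relation.Binary.PropositionalEquality using (_≡_; _≢_)
open import Relation.Nullary using (¬_)
open import Relation.Nullary.Decidable using (⌊_⌋)

-- X = Fin n.  A split A|(X-A) is represented by one of its sides A.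
-- Two representatives denote the same split iff they are equal or
-- complementary.

SameSplit : ∀ {n} → Subset n → Subset n → Set
SameSplit A B = A ≡ B ⊎ A ≡ ∁ B

IsSplit : ∀ {n} → Subset n → Set
IsSplit A = Nonempty A × Nonempty (∁ A)

SplitSystem : ∀ {n} → List (Subset n) → Set
SplitSystem S = ∀ A → A Mem.∈ S → IsSplit A

_≈ₛ_ : ∀ {n} → List (Subset n) → List (Subset n) → Set
S ≈ₛ S′ = Permutation SameSplit S S′

CompatiblePair : ∀ {n} → Subset n → Subset n → Set
CompatiblePair A₁ A₂ =
  Empty (A₁ ∩ A₂) ⊎ Empty (A₁ ∩ ∁ A₂) ⊎ Empty (∁ A₁ ∩ A₂) ⊎ Empty (∁ A₁ ∩ ∁ A₂)

Compatible : ∀ {n} → List (Subset n) → Set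
Compatible S = ∀ A₁ A₂ → A₁ Mem.∈ S → A₂ Mem.∈ S → CompatiblePair A₁ A₂

IsPartition : ∀ {n} → List (Subset n) → Set
IsPartition {n} π =
  (2 ≤ length π)
  × (∀ A → A Mem.∈ π → Nonempty A)
  × (∀ (i j : Fin (length π)) → i ≢ j → Empty (lookup π i ∩ lookup π j))
  × (∀ (x : Fin n) → Any (x ∈_) π)

PartitionSystem : ∀ {n} → List (List (Subset n)) → Set
PartitionSystem Π = ∀ π → π Mem.∈ Π → IsPartition π

-- Σ_Π : each part A of each partition contributes the split A|(X-A).
splitsOf : ∀ {n} → List (List (Subset n)) → List (Subset n)
splitsOf Π = concat Π

_∈ℙ_ : ∀ {n} → List (List (Subset n)) → List (Subset n) → Set
Π ∈ℙ S = PartitionSystem Π × (splitsOf Π ≈ₛ S)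

Graph : ℕ → Set
Graph m = List (Fin m × Fin m)

Adj : ∀ {m} → Graph m → Fin m → Fin m → Set
Adj E u v = (u , v) Mem.∈ E ⊎ (v , u) Mem.∈ E

data Walk {m} (E : Graph m) : Fin m → Fin m → ℕ → Set where
  here : ∀ {u} → Walk E u u zero
  step : ∀ {u w v k} → Adj E u w → Walk E w v k → Walk E u v (suc k)

Reach : ∀ {m} → Graph m → Fin m → Fin m → Set
Reach E u v = ∃[ k ] Walk E u v k

Connected : ∀ {m} → Graph m → Set
Connected E = ∀ u v → Reach E u v

-- Acyclic: no edge lies on a cycle, i.e. after deleting any edge its
-- endpoints are no longer joined.
Acyclic : ∀ {m} → Graph m → Set
Acyclic E = ∀ (i : Fin (length E)) →
  ¬ Reach (removeAt E i) (proj₁ (lookup E i)) (proj₂ (lookup E i))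

IsTree : ∀ {m} → Graph m → Set
IsTree E = Connected E × Acyclic E

degree : ∀ {m} → Graph m → Fin m → ℕ
degree E v = length (filterᵇ (λ e → ⌊ proj₁ e ≟ v ⌋ ∨ ⌊ proj₂ e ≟ v ⌋) E)

Leaf : ∀ {m} → Graph m → Fin m → Set
Leaf E v = degree E v ≡ 1

IsWeakXTree : ∀ {n m} → Graph m → (Fin n → Fin m) → Set
IsWeakXTree E φ = IsTree E × (∀ v → Leaf E v → ∃[ x ] φ x ≡ v)

-- The split induced by edge i, represented by the side φ⁻¹(W), W the
-- component of T - e containing the first endpoint of e.
InducedSplit : ∀ {n m} (E : Graph m) (φ : Fin n → Fin m) →
               Fin (length E) → Subset n → Set
InducedSplit E φ i A =
  ∀ x → (x ∈ A) ⇔ Reach (removeAt E i) (proj₁ (lookup E i)) (φ x)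

EdgeSplitsAre : ∀ {n m} → Graph m → (Fin n → Fin m) → List (Subset n) → Set
EdgeSplitsAre {n} E φ S =
  ∃[ ss ] ((∀ i → InducedSplit E φ i (ss i)) × (tabulate ss ≈ₛ S))

Dist≤ : ∀ {m} → Graph m → Fin m → Fin m → ℕ → Set
Dist≤ E u v k = ∃[ j ] (j ≤ k × Walk E u v j)

Diameter≤ : ∀ {m} → Graph m → ℕ → Set
Diameter≤ E k = ∀ u v → Leaf E u → Leaf E v → Dist≤ E u v k

module Submission where

-- Let u, v be leaves of the weak X-tree (T; φ) whose edge
-- splits form Σ, and pick labels x, y with φ x = u and φ y = v.
--   * Every edge of a simple u–v path is a bridge that the path crosses,
--     so its induced split separates x from y; and a simple path uses each
--     edge once.  Hence d_T(u, v) is at most the number of splits of Σ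
--     separating x from y (tree-distance≤separating).
--   * Σ is also the multiset of all parts of the partitions in Π.  A
--     partition has at most one part containing x and at most one
--     containing y, so at most two of its parts separate x from y; summing
--     over Π bounds the number of separating splits by 2|Π|
--     (separating-splits≤).

open import Defs
open import Data.Nat using (ℕ; _≤_; _*_; suc; _+_; z≤n; s≤s)
open import Data.Nat.Properties
  using (≤-trans; ≤-reflexive; +-mono-≤; +-monoʳ-≤; +-suc; *-suc; n≤1+n; m≤n⇒m≤1+n; module ≤-Reasoning)
open import Data.Bool using (Bool; true; false; not; _xor_; T; T?)
open import Data.Bool.Properties using (not-distribˡ-xor; not-distribʳ-xor; not-involutive; T-≡)
open import Data.Fin using (Fin; _≟_)
open import Data.Fin.Properties using (suc-injective)
open import Data.Fin.Subset using (Subset; _∈_; _∉_; ∁; _∩_; Empty)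
open import Data.Fin.Subset.Properties using (x∈p∩q⁺)
open import Data.Vec using () renaming (lookup to vlookup)
open import Data.Vec.Properties using ([]=⇒lookup; lookup⇒[]=; lookup-map)
open import Data.List
  using (List; length; []; _∷_; _++_; map; filterᵇ; tabulate; allFin; removeAt; lookup; concat)
open import Data.List.Properties
  using (filter-++; filter-none; length-++; map-tabulate; length-removeAt′)
open import Data.List.Relation.Unary.Any using (here; there; index)
open import Data.List.Relation.Unary.Any.Properties using (lookup-index)
import Data.List.Relation.Unary.All as All
open import Data.List.Relation.Unary.Unique.Propositional using (Unique; []; _∷_)
open import Data.List.Membership.Propositional as List using ()
open import Data.List.Membership.Propositional.Properties using (∈-filter⁺; ∈-allFin)
open import Data.List.Relation.Binary.Permutation.Homogeneous as Homogeneous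
  using (Permutation)
import Data.List.Relation.Binary.Permutation.Setoid.Properties as PermutationProperties
open import Data.Product using (_×_; _,_; ∃-syntax; Σ; proj₁; proj₂)
open import Data.Sum using (_⊎_; inj₁; inj₂)
open import Data.Empty using (⊥-elim)
open import Data.Unit using (⊤; tt)
open import Function using (_∘_; id)
open import Function.Bundles using (Equivalence)
open import Relation.Binary.PropositionalEquality as ≡
  using (_≡_; _≢_; refl; sym; trans; cong; cong₂; subst)
import Relation.Binary.Construct.On as On
open import Relation.Nullary using (¬_; Dec; yes; no)

count : ∀ {A : Set} → (A → Bool) → List A → ℕ
count p xs = length (filterᵇ p xs)

count-++ : ∀ {A : Set} (p : A → Bool) (xs ys : List A) →
           count p (xs ++ ys) ≡ count p xs + count p ys
count-++ p xs ys = trans (cong length (filter-++ (T? ∘ p) xs ys)) (length-++ (filterᵇ p xs))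

count-map : ∀ {A B : Set} (p : B → Bool) (f : A → B) (xs : List A) →
            count p (map f xs) ≡ count (p ∘ f) xs
count-map p f [] = refl
count-map p f (x ∷ xs) with p (f x)
... | true  = cong suc (count-map p f xs)
... | false = count-map p f xs

-- The test induces the setoid "same test value", to which R maps.
count-resp-↭ : ∀ {A : Set} {R : A → A → Set} (p : A → Bool) →
               (∀ {a b} → R a b → p a ≡ p b) →
               ∀ {xs ys} → Permutation R xs ys → count p xs ≡ count p ys
count-resp-↭ p p-resp xs↭ys =
  xs↭ys⇒|xs|≡|ys| (filter⁺ (T? ∘ p) (subst T) (Homogeneous.map p-resp xs↭ys))
  where open PermutationProperties (On.setoid (≡.setoid Bool) p)

count-xor : ∀ {A : Set} (f g : A → Bool) (xs : List A) →
            count (λ a → f a xor g a) xs ≤ count f xs + count g xs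
count-xor f g [] = z≤n
count-xor f g (x ∷ xs) with f x | g x | count-xor f g xs
... | true  | true  | ih = m≤n⇒m≤1+n (≤-trans ih (+-monoʳ-≤ (count f xs) (n≤1+n (count g xs))))
... | true  | false | ih = s≤s ih
... | false | true  | ih =
  subst (suc (count (λ a → f a xor g a) xs) ≤_) (sym (+-suc (count f xs) (count g xs))) (s≤s ih)
... | false | false | ih = ih

∈-removeAt⁺ : ∀ {A : Set} {x : A} (xs : List A) (i : Fin (length xs)) →
              x List.∈ xs → x ≢ lookup xs i → x List.∈ removeAt xs i
∈-removeAt⁺ (y ∷ xs) Fin.zero    (here x≡y)   x≢y = ⊥-elim (x≢y x≡y)
∈-removeAt⁺ (y ∷ xs) Fin.zero    (there x∈xs) _   = x∈xs
∈-removeAt⁺ (y ∷ xs) (Fin.suc i) (here x≡y)   _   = here x≡y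
∈-removeAt⁺ (y ∷ xs) (Fin.suc i) (there x∈xs) x≢  = there (∈-removeAt⁺ xs i x∈xs x≢)

unique-⊆⇒length≤ : ∀ {A : Set} {xs ys : List A} → Unique xs →
                   (∀ {x} → x List.∈ xs → x List.∈ ys) → length xs ≤ length ys
unique-⊆⇒length≤ [] _ = z≤n
unique-⊆⇒length≤ {xs = x ∷ xs} {ys} (x∉xs ∷ xs-unique) xs⊆ys = begin
  suc (length xs)              ≤⟨ s≤s (unique-⊆⇒length≤ xs-unique xs⊆ys-x) ⟩
  suc (length (removeAt ys i)) ≡⟨ sym (length-removeAt′ ys i) ⟩
  length ys                    ∎
  where
  open ≤-Reasoning
  x∈ys = xs⊆ys (here refl)
  i = index x∈ys
  xs⊆ys-x : ∀ {y} → y List.∈ xs → y List.∈ removeAt ys i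
  xs⊆ys-x y∈xs = ∈-removeAt⁺ ys i (xs⊆ys (there y∈xs))
    λ y≡xᵢ → All.lookup x∉xs y∈xs (trans (lookup-index x∈ys) (sym y≡xᵢ))

SeparatedBy : ∀ {n} → Subset n → Fin n → Fin n → Set
SeparatedBy A x y = (x ∈ A × y ∉ A) ⊎ (x ∉ A × y ∈ A)

separates : ∀ {n} → Fin n → Fin n → Subset n → Bool
separates x y A = vlookup A x xor vlookup A y

∉⇒lookup≡false : ∀ {n} {x : Fin n} (A : Subset n) → x ∉ A → vlookup A x ≡ false
∉⇒lookup≡false {x = x} A x∉A with vlookup A x in eq
... | true  = ⊥-elim (x∉A (lookup⇒[]= x A eq))
... | false = refl

separatedBy⇒separates : ∀ {n} {A : Subset n} {x y} → SeparatedBy A x y → T (separates x y A)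
separatedBy⇒separates {A = A} (inj₁ (x∈A , y∉A))
  rewrite []=⇒lookup x∈A | ∉⇒lookup≡false A y∉A = tt
separatedBy⇒separates {A = A} (inj₂ (x∉A , y∈A))
  rewrite []=⇒lookup y∈A | ∉⇒lookup≡false A x∉A = tt

separates-resp-SameSplit : ∀ {n} (x y : Fin n) {A B : Subset n} →
                           SameSplit A B → separates x y A ≡ separates x y B
separates-resp-SameSplit x y (inj₁ refl) = refl
separates-resp-SameSplit x y {B = B} (inj₂ refl) = begin
  vlookup (∁ B) x xor vlookup (∁ B) y ≡⟨ cong₂ _xor_ (lookup-map x not B) (lookup-map y not B) ⟩
  not b xor not c                     ≡⟨ sym (not-distribˡ-xor b (not c)) ⟩
  not (b xor not c)                   ≡⟨ cong not (sym (not-distribʳ-xor b c)) ⟩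
  not (not (b xor c))                 ≡⟨ not-involutive (b xor c) ⟩
  b xor c                             ∎
  where
  open ≡.≡-Reasoning
  b = vlookup B x
  c = vlookup B y

PairwiseDisjoint : ∀ {n} → List (Subset n) → Set
PairwiseDisjoint π = ∀ (i j : Fin (length π)) → i ≢ j → Empty (lookup π i ∩ lookup π j)

count-containing≤1 : ∀ {n} (x : Fin n) (π : List (Subset n)) → PairwiseDisjoint π →
                     count (λ A → vlookup A x) π ≤ 1
count-containing≤1 x [] _ = z≤n
count-containing≤1 x (B ∷ π) disjoint with vlookup B x in x∈B
... | true  = s≤s (≤-reflexive (cong length none))
  where
  outside-rest : ∀ {A} → A List.∈ π → ¬ T (vlookup A x)
  outside-rest {A} A∈π x∈A = disjoint Fin.zero (Fin.suc (index A∈π)) (λ ())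
    (x , x∈p∩q⁺ (lookup⇒[]= x B x∈B ,
                 subst (x ∈_) (lookup-index A∈π) (lookup⇒[]= x A (Equivalence.to T-≡ x∈A))))
  none : filterᵇ (λ A → vlookup A x) π ≡ []
  none = filter-none (T? ∘ (λ A → vlookup A x)) (All.tabulate outside-rest)
... | false = count-containing≤1 x π (λ i j i≢j → disjoint (Fin.suc i) (Fin.suc j) (i≢j ∘ suc-injective))

separating-parts≤2 : ∀ {n} (x y : Fin n) (π : List (Subset n)) → PairwiseDisjoint π →
                     count (separates x y) π ≤ 2
separating-parts≤2 x y π disjoint =
  ≤-trans (count-xor (λ A → vlookup A x) (λ A → vlookup A y) π)
          (+-mono-≤ (count-containing≤1 x π disjoint) (count-containing≤1 y π disjoint))

separating-parts-of-system≤ : ∀ {n} (x y : Fin n) (Π : List (List (Subset n))) →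
                              PartitionSystem Π → count (separates x y) (concat Π) ≤ 2 * length Π
separating-parts-of-system≤ x y [] _ = z≤n
separating-parts-of-system≤ x y (π ∷ Π) partitions = begin
  count (separates x y) (π ++ concat Π)                 ≡⟨ count-++ (separates x y) π (concat Π) ⟩
  count (separates x y) π + count (separates x y) (concat Π)
    ≤⟨ +-mono-≤ (separating-parts≤2 x y π disjoint)
                (separating-parts-of-system≤ x y Π (λ π′ → partitions π′ ∘ there)) ⟩
  2 + 2 * length Π                                      ≡⟨ sym (*-suc 2 (length Π)) ⟩
  2 * length (π ∷ Π)                                    ∎
  where
  open ≤-Reasoning
  disjoint : PairwiseDisjoint π
  disjoint = proj₁ (proj₂ (proj₂ (partitions π (here refl))))

separating-splits≤ : ∀ {n} (x y : Fin n) {S : List (Subset n)} {Π : List (List (Subset n))} →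
                     Π ∈ℙ S → count (separates x y) S ≤ 2 * length Π
separating-splits≤ x y {Π = Π} (partitions , Π≈S) =
  subst (_≤ 2 * length Π)
        (count-resp-↭ (separates x y) (separates-resp-SameSplit x y) Π≈S)
        (separating-parts-of-system≤ x y Π partitions)

module _ {m : ℕ} {G : Graph m} where

  adj-sym : ∀ {a b} → Adj G a b → Adj G b a
  adj-sym (inj₁ ab∈G) = inj₂ ab∈G
  adj-sym (inj₂ ba∈G) = inj₁ ba∈G

  _++ʷ_ : ∀ {a b c k l} → Walk G a b k → Walk G b c l → Walk G a c (k + l)
  here       ++ʷ w′ = w′
  step ab w ++ʷ w′ = step ab (w ++ʷ w′)

  reach-trans : ∀ {a b c} → Reach G a b → Reach G b c → Reach G a c
  reach-trans (_ , w) (_ , w′) = _ , w ++ʷ w′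

  reach-sym : ∀ {a b} → Reach G a b → Reach G b a
  reach-sym (_ , here)      = 0 , here
  reach-sym (_ , step ab w) = reach-trans (reach-sym (_ , w)) (1 , step (adj-sym ab) here)

  _∈ʷ_ : ∀ {u v k} → Fin m → Walk G u v k → Set
  _∈ʷ_ {u = u} c here       = c ≡ u
  _∈ʷ_ {u = u} c (step _ w) = c ≡ u ⊎ c ∈ʷ w

  start∈ʷ : ∀ {u v k} (w : Walk G u v k) → u ∈ʷ w
  start∈ʷ here       = refl
  start∈ʷ (step _ w) = inj₁ refl

  _∈ʷ?_ : ∀ {u v k} (c : Fin m) (w : Walk G u v k) → Dec (c ∈ʷ w)
  _∈ʷ?_ {u = u} c here = c ≟ u
  _∈ʷ?_ {u = u} c (step _ w) with c ≟ u | c ∈ʷ? w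
  ... | yes c≡u | _       = yes (inj₁ c≡u)
  ... | no  _   | yes c∈w = yes (inj₂ c∈w)
  ... | no  c≢u | no  c∉w = no λ { (inj₁ c≡u) → c≢u c≡u ; (inj₂ c∈w) → c∉w c∈w }

  Simple : ∀ {u v k} → Walk G u v k → Set
  Simple here                = ⊤
  Simple {u = u} (step _ w) = ¬ u ∈ʷ w × Simple w

  SimplePath : Fin m → Fin m → Set
  SimplePath u v = ∃[ k ] Σ (Walk G u v k) Simple

  suffixFrom : ∀ {u v k c} (w : Walk G u v k) → Simple w → c ∈ʷ w → SimplePath c v
  suffixFrom here        _                refl       = 0 , here , tt
  suffixFrom (step ab w) simple           (inj₁ refl) = _ , step ab w , simple
  suffixFrom (step ab w) (_ , simple)     (inj₂ c∈w)  = suffixFrom w simple c∈w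

  shortcut : ∀ {u v k} → Walk G u v k → SimplePath u v
  shortcut here = 0 , here , tt
  shortcut {u = u} (step ab w) with shortcut w
  ... | _ , w′ , simple with u ∈ʷ? w′
  ...   | yes u∈w′ = suffixFrom w′ simple u∈w′
  ...   | no  u∉w′ = _ , step ab w′ , u∉w′ , simple

  dist≤-mono : ∀ {u v k l} → k ≤ l → Dist≤ G u v k → Dist≤ G u v l
  dist≤-mono k≤l (j , j≤k , w) = j , ≤-trans j≤k k≤l , w

Crosses : ∀ {m} → Graph m → Fin m × Fin m → Fin m → Fin m → Set
Crosses G (p , q) u v = (Reach G u p × Reach G q v) ⊎ (Reach G u q × Reach G p v)

crosses-extend : ∀ {m} {G : Graph m} {e u u′ v} →
                 Reach G u u′ → Crosses G e u′ v → Crosses G e u v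
crosses-extend uu′ (inj₁ (u′p , qv)) = inj₁ (reach-trans uu′ u′p , qv)
crosses-extend uu′ (inj₂ (u′q , pv)) = inj₂ (reach-trans uu′ u′q , pv)

module Edges {m : ℕ} (E : Graph m) where

  E∖ : Fin (length E) → Graph m
  E∖ j = removeAt E j

  Joins : Fin (length E) → Fin m → Fin m → Set
  Joins j p q = lookup E j ≡ (p , q) ⊎ lookup E j ≡ (q , p)

  _isEndOf_ : Fin m → Fin (length E) → Set
  c isEndOf j = c ≡ proj₁ (lookup E j) ⊎ c ≡ proj₂ (lookup E j)

  joins⇒isEndOf : ∀ {j p q} → Joins j p q → p isEndOf j
  joins⇒isEndOf (inj₁ jpq) = inj₁ (cong proj₁ (sym jpq))
  joins⇒isEndOf (inj₂ jqp) = inj₂ (cong proj₂ (sym jqp))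

  isEndOf-joins : ∀ {j p q c} → Joins j p q → c isEndOf j → c ≡ p ⊎ c ≡ q
  isEndOf-joins (inj₁ jpq) (inj₁ c≡) = inj₁ (trans c≡ (cong proj₁ jpq))
  isEndOf-joins (inj₁ jpq) (inj₂ c≡) = inj₂ (trans c≡ (cong proj₂ jpq))
  isEndOf-joins (inj₂ jqp) (inj₁ c≡) = inj₂ (trans c≡ (cong proj₁ jqp))
  isEndOf-joins (inj₂ jqp) (inj₂ c≡) = inj₁ (trans c≡ (cong proj₂ jqp))

  adj-survives : ∀ {j p q} → Adj E p q → ¬ Joins j p q → Adj (E∖ j) p q
  adj-survives {j} (inj₁ pq∈E) ¬joins = inj₁ (∈-removeAt⁺ E j pq∈E (¬joins ∘ inj₁ ∘ sym))
  adj-survives {j} (inj₂ qp∈E) ¬joins = inj₂ (∈-removeAt⁺ E j qp∈E (¬joins ∘ inj₂ ∘ sym))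

  edgeIndex : ∀ {p q} → Adj E p q → Fin (length E)
  edgeIndex (inj₁ pq∈E) = index pq∈E
  edgeIndex (inj₂ qp∈E) = index qp∈E

  edgeIndex-joins : ∀ {p q} (pq : Adj E p q) → Joins (edgeIndex pq) p q
  edgeIndex-joins (inj₁ pq∈E) = inj₁ (sym (lookup-index pq∈E))
  edgeIndex-joins (inj₂ qp∈E) = inj₂ (sym (lookup-index qp∈E))

  edgesOf : ∀ {u v k} → Walk E u v k → List (Fin (length E))
  edgesOf here        = []
  edgesOf (step pq w) = edgeIndex pq ∷ edgesOf w

  length-edgesOf : ∀ {u v k} (w : Walk E u v k) → length (edgesOf w) ≡ k
  length-edgesOf here       = refl
  length-edgesOf (step _ w) = cong suc (length-edgesOf w)

  edgesOf-ends : ∀ {u v k j c} (w : Walk E u v k) → j List.∈ edgesOf w → c isEndOf j → c ∈ʷ w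
  edgesOf-ends (step pq w) (here refl) c-end with isEndOf-joins (edgeIndex-joins pq) c-end
  ... | inj₁ refl = inj₁ refl
  ... | inj₂ refl = inj₂ (start∈ʷ w)
  edgesOf-ends (step _ w) (there j∈w) c-end = inj₂ (edgesOf-ends w j∈w c-end)

  edgesOf-unique : ∀ {u v k} (w : Walk E u v k) → Simple w → Unique (edgesOf w)
  edgesOf-unique here _ = []
  edgesOf-unique (step uw w) (u∉w , simple) =
    All.tabulate first-not-again ∷ edgesOf-unique w simple
    where
    first-not-again : ∀ {j} → j List.∈ edgesOf w → edgeIndex uw ≢ j
    first-not-again j∈w refl = u∉w (edgesOf-ends w j∈w (joins⇒isEndOf (edgeIndex-joins uw)))

  avoid : ∀ {j c a b k} → c isEndOf j → (w : Walk E a b k) → ¬ c ∈ʷ w → Walk (E∖ j) a b k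
  avoid c-end here _ = here
  avoid {j} {a = a} c-end (step {w = a′} aa′ w) c∉ =
    step (adj-survives aa′ ¬joins) (avoid c-end w (c∉ ∘ inj₂))
    where
    ¬joins : ¬ Joins j a a′
    ¬joins joins with isEndOf-joins joins c-end
    ... | inj₁ refl = c∉ (inj₁ refl)
    ... | inj₂ refl = c∉ (inj₂ (start∈ʷ w))

  joins-crosses : ∀ {j p q v} → Joins j p q → Reach (E∖ j) q v → Crosses (E∖ j) (lookup E j) p v
  joins-crosses {j} {p} {q} {v} (inj₁ jpq) qv =
    subst (λ e → Crosses (E∖ j) e p v) (sym jpq) (inj₁ ((0 , here) , qv))
  joins-crosses {j} {p} {q} {v} (inj₂ jqp) qv =
    subst (λ e → Crosses (E∖ j) e p v) (sym jqp) (inj₂ ((0 , here) , qv))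

  simple-crosses : ∀ {u v k j} (w : Walk E u v k) → Simple w → j List.∈ edgesOf w →
                   Crosses (E∖ j) (lookup E j) u v
  simple-crosses (step uu′ w) (u∉w , _) (here refl) =
    joins-crosses (edgeIndex-joins uu′) (_ , avoid (joins⇒isEndOf (edgeIndex-joins uu′)) w u∉w)
  simple-crosses {u} {j = j} (step {w = u′} uu′ w) (u∉w , simple) (there j∈w) =
    crosses-extend (1 , step (adj-survives uu′ ¬joins) here) (simple-crosses w simple j∈w)
    where
    ¬joins : ¬ Joins j u u′
    ¬joins joins = u∉w (edgesOf-ends w j∈w (joins⇒isEndOf joins))

module _ {n m} (E : Graph m) (φ : Fin n → Fin m) (j : Fin (length E)) (A : Subset n)
         (bridge : ¬ Reach (removeAt E j) (proj₁ (lookup E j)) (proj₂ (lookup E j)))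
         (induced : InducedSplit E φ j A) where

  private
    near-side : ∀ {z} → Reach (removeAt E j) (proj₁ (lookup E j)) (φ z) → z ∈ A
    near-side = Equivalence.from (induced _)

    far-side : ∀ {z} → Reach (removeAt E j) (proj₂ (lookup E j)) (φ z) → z ∉ A
    far-side qz z∈A = bridge (reach-trans (Equivalence.to (induced _) z∈A) (reach-sym qz))

  bridge-separates : ∀ {x y} → Crosses (removeAt E j) (lookup E j) (φ x) (φ y) → SeparatedBy A x y
  bridge-separates (inj₁ (xp , qy)) = inj₁ (near-side (reach-sym xp) , far-side qy)
  bridge-separates (inj₂ (xq , py)) = inj₂ (far-side (reach-sym xq) , near-side py)

-- In a weak X-tree with edge splits Σ, the distance between φ x and φ y is
-- at most the number of splits of Σ separating x and y: a simple path
-- between them uses distinct edges, each a bridge whose split separates.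
tree-distance≤separating : ∀ {n m} (E : Graph m) (φ : Fin n → Fin m) {S : List (Subset n)} →
                           IsTree E → EdgeSplitsAre E φ S →
                           ∀ x y → Dist≤ E (φ x) (φ y) (count (separates x y) S)
tree-distance≤separating E φ {S} (connected , acyclic) (ss , induced , ss≈S) x y
  with shortcut (proj₂ (connected (φ x) (φ y)))
... | k , w , simple = k , k≤ , w
  where
  open Edges E

  separating : Fin (length E) → Bool
  separating i = separates x y (ss i)

  edges-separate : ∀ {i} → i List.∈ edgesOf w → i List.∈ filterᵇ separating (allFin (length E))
  edges-separate {i} i∈w = ∈-filter⁺ (T? ∘ separating) (∈-allFin i)
    (separatedBy⇒separates (bridge-separates E φ i (ss i) (acyclic i) (induced i)
                                               (simple-crosses w simple i∈w)))

  k≤ : k ≤ count (separates x y) S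
  k≤ = begin
    k                                            ≡⟨ sym (length-edgesOf w) ⟩
    length (edgesOf w)                           ≤⟨ unique-⊆⇒length≤ (edgesOf-unique w simple) edges-separate ⟩
    count separating (allFin (length E))         ≡⟨ sym (count-map (separates x y) ss (allFin (length E))) ⟩
    count (separates x y) (map ss (allFin (length E))) ≡⟨ cong (count (separates x y)) (map-tabulate id ss) ⟩
    count (separates x y) (tabulate ss)          ≡⟨ count-resp-↭ (separates x y) (separates-resp-SameSplit x y) ss≈S ⟩
    count (separates x y) S                      ∎
    where open ≤-Reasoning

corollary3p3 : ∀ {n} → 2 ≤ n →
    (S : List (Subset n)) → SplitSystem S → Compatible S →
    (Π : List (List (Subset n))) → Π ∈ℙ S →
    ∀ {m} (E : Graph m) (φ : Fin n → Fin m) →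
    IsWeakXTree E φ → EdgeSplitsAre E φ S →
    Diameter≤ E (2 * length Π)
corollary3p3 _ S _ _ Π Π∈ℙS E φ (tree , leaves-labelled) edge-splits u v u-leaf v-leaf
  with leaves-labelled u u-leaf | leaves-labelled v v-leaf
... | x , refl | y , refl =
  dist≤-mono (separating-splits≤ x y Π∈ℙS) (tree-distance≤separating E φ tree edge-splits x y)
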